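{- Let $G$ be either (1) an odd cycle $C_n$, or (2) a flower $F(r,2k+1)$ with $r\ge 2$ and $k\ge 1$. Then every set consisting of a single vertex of $G$ is a skew forcing set of $G$, but the empty set is not; consequently $\mathfrak{Z}^-(G)\cong Q_n-v$, where $n=|V(G)|$ and $v$ is any vertex of $Q_n$.
   Context: All graphs are finite, simple, undirected. Skew color change rule: given the current white set $W$, any vertex $u$ may turn a white vertex $w$ blue if $N(u)\cap W=\{w\}$. A skew forcing set is a set $S$ such that starting with exactly $S$ blue, repeated application makes every vertex blue. The skew TAR graph $\mathfrak{Z}^-(G)$ has the skew forcing sets as vertices, two adjacent iff their symmetric difference has exactly one element. $Q_n$ is the $n$-dimensional hypercube. For $r\ge 2$, $s\ge 3$, the flower $F(r,s)$ is the union of $r$ copies of the cycle $C_s$ sharing exactly one common vertex. -}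

module Defs where

open import Data.Nat using (ℕ; zero; suc; _+_; _*_; _<_)
open import Data.Fin using (Fin; toℕ)
open import Data.Fin.Subset using (Subset; _∈_; _∉_; _∪_; _─_; ⁅_⁆; ∣_∣)
  renaming (⊤ to full; ⊥ to empty)
open import Data.Product using (Σ; ∃; _×_)
open import Data.Sum using (_⊎_)
open import Relation.Binary.PropositionalEquality using (_≡_)
open import Relation.Nullary using (¬_)
open import Function using (_⇔_)

-- A finite simple graph on vertex set Fin n, given by its adjacency relation
-- (the concrete graphs below are symmetric and loopless by construction).
Graph : ℕ → Set₁
Graph n = Fin n → Fin n → Set

SkewForces : ∀ {n} → Graph n → Subset n → Fin n → Fin n → Set
SkewForces G B u w =
  w ∉ B × G u w × (∀ x → x ∉ B → G u x → x ≡ w)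

data SkewReach {n} (G : Graph n) (S : Subset n) : Subset n → Set where
  start : SkewReach G S S
  step  : ∀ {B u w} → SkewReach G S B → SkewForces G B u w →
          SkewReach G S (B ∪ ⁅ w ⁆)

IsSkewForcing : ∀ {n} → Graph n → Subset n → Set
IsSkewForcing G S = SkewReach G S full

-- Two subsets are adjacent (in Q_n and in the skew TAR graph) iff their
-- symmetric difference has exactly one element.
SymDiff1 : ∀ {n} → Subset n → Subset n → Set
SymDiff1 S T = ∣ (S ─ T) ∪ (T ─ S) ∣ ≡ 1

-- Graph isomorphism between the induced subgraphs of Q_n on the vertex sets
-- {S | P S} and {T | Q T} (adjacency = symmetric difference of size one).
record InducedIso {n} (P Q : Subset n → Set) : Set where
  field
    to      : Subset n → Subset n
    from    : Subset n → Subset n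
    to-ok   : ∀ S → P S → Q (to S)
    from-ok : ∀ T → Q T → P (from T)
    from-to : ∀ S → P S → from (to S) ≡ S
    to-from : ∀ T → Q T → to (from T) ≡ T
    adj     : ∀ S S′ → P S → P S′ → SymDiff1 S S′ ⇔ SymDiff1 (to S) (to S′)

-- 𝔷⁻(G) ≅ Q_n − v : vertices of Q_n − v are the subsets different from v.
SkewTAR≅Qn-v : ∀ {n} → Graph n → Subset n → Set
SkewTAR≅Qn-v G v = InducedIso (IsSkewForcing G) (λ T → ¬ T ≡ v)

Conclusion : ∀ {n} → Graph n → Set
Conclusion {n} G =
  (∀ (x : Fin n) → IsSkewForcing G ⁅ x ⁆) ×
  ¬ IsSkewForcing G empty ×
  (∀ (v : Subset n) → SkewTAR≅Qn-v G v)

CycAdj : (n : ℕ) → Fin n → Fin n → Set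
CycAdj n i j =
  toℕ j ≡ suc (toℕ i) ⊎ toℕ i ≡ suc (toℕ j) ⊎
  (toℕ i ≡ 0 × suc (toℕ j) ≡ n) ⊎ (toℕ j ≡ 0 × suc (toℕ i) ≡ n)

-- The flower F(r, 2k+1) on 1 + r·2k vertices: center 0, petal p < r has
-- path vertices 1 + p·2k + t (t < 2k), whose ends are joined to the center.

PetalEdge : ℕ → ℕ → ℕ → ℕ → Set
PetalEdge r k a b = Σ ℕ λ p → Σ ℕ λ t →
  p < r × suc t < 2 * k × a ≡ 1 + p * (2 * k) + t × b ≡ suc a

CenterEdge : ℕ → ℕ → ℕ → ℕ → Set
CenterEdge r k a b = a ≡ 0 × Σ ℕ λ p →
  p < r × (b ≡ 1 + p * (2 * k) ⊎ b ≡ p * (2 * k) + 2 * k)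

FlowerAdj : (r k : ℕ) → Fin (suc (r * (2 * k))) → Fin (suc (r * (2 * k))) → Set
FlowerAdj r k i j =
  PetalEdge r k (toℕ i) (toℕ j) ⊎ PetalEdge r k (toℕ j) (toℕ i) ⊎
  CenterEdge r k (toℕ i) (toℕ j) ⊎ CenterEdge r k (toℕ j) (toℕ i)

Odd : ℕ → Set
Odd n = ∃ λ m → n ≡ suc (2 * m)

module Submission where

-- A skew force may be made by a white vertex, so along a path whose interior vertices
-- have degree two a blue vertex turns the vertex two steps further blue, in either
-- direction. A petal is an odd closed walk through the centre c, so c sits at the two
-- ends 0 and 2k+1 of different parity: blue spreads from c to every vertex of the
-- petal and from every vertex back to c. Hence {c}, and then every singleton, is skew
-- forcing, and so is every nonempty set. The empty set is not: every vertex has two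
-- neighbours, so while all vertices are white no vertex can force.
-- Translation by v (symmetric difference with v) is an automorphism of Q_n taking ∅
-- to v. Finally, the odd cycle C_{2k+1} is the one-petal flower F(1, 2k+1).

open import Defs
open import Data.Bool using (true; false; _xor_)
open import Data.Bool.Properties using (xor-assoc; xor-same; xor-identityʳ)
open import Data.Empty using (⊥-elim)
open import Data.Fin using (Fin; toℕ; fromℕ<; combine; remQuot) renaming (zero to fz; suc to fs)
open import Data.Fin.Properties
  using (_≟_; toℕ<n; toℕ-injective; toℕ-fromℕ<; fromℕ<-toℕ; toℕ-combine; combine-remQuot)
open import Data.Fin.Subset using (Subset; _∈_; _∉_; _⊆_; _∪_; _─_; ⁅_⁆; ∣_∣)
  renaming (⊤ to full; ⊥ to empty)
open import Data.Fin.Subset.Properties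
  using (_∈?_; ∈⊤; ∉⊥; ⊆⊤; ⊆-antisym; x∈⁅x⁆; x∈⁅y⁆⇒x≡y; x∈p∪q⁻; p⊆p∪q; q⊆p∪q;
         nonempty?; Empty-unique)
open import Data.List using (List; []; _∷_; allFin)
open import Data.List.Membership.Propositional.Properties using (∈-allFin)
open import Data.List.Relation.Unary.Any using (here; there)
import Data.List.Membership.Propositional as List
open import Data.Nat using (ℕ; zero; suc; _+_; _*_; _≤_; _<_; _<?_; z≤n; s≤s; s≤s⁻¹; NonZero)
open import Data.Nat.DivMod using (_%_; m<n⇒m%n≡m; [m+kn]%n≡m%n)
open import Data.Nat.Properties
  using (suc-injective; 1+n≢0; +-suc; +-comm; +-identityʳ; +-cancelˡ-≡; *-comm; *-identityˡ;
         ≤-refl; ≤-reflexive; ≤-trans; ≤-antisym; <-irrefl; ≮⇒≥; n≤1+n; m≤n⇒m≤1+n; <⇒≤)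
open import Data.Product using (∃; _×_; _,_; proj₁; proj₂)
open import Data.Sum using (_⊎_; inj₁; inj₂; swap)
open import Data.Sum.Function.Propositional using (_⊎-⇔_)
open import Data.Vec using ([]; _∷_; zipWith)
open import Function using (_∘_; id; _⇔_; mk⇔; Equivalence)
open import Function.Construct.Composition using (_⇔-∘_)
open import Function.Construct.Identity using (⇔-id)
open import Function.Construct.Symmetry using (⇔-sym)
open import Relation.Binary.Definitions using (Symmetric)
open import Relation.Binary.PropositionalEquality
open import Relation.Nullary using (¬_; Dec; yes; no)

module SkewForcing {n : ℕ} (G : Graph n) where

  skewReach-⊇ : ∀ {S B} → SkewReach G S B → S ⊆ B
  skewReach-⊇ start = id
  skewReach-⊇ (step {w = w} r _) = p⊆p∪q ⁅ w ⁆ ∘ skewReach-⊇ r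

  ⁅⁆-⊆ : ∀ {D : Subset n} {w} → w ∈ D → ⁅ w ⁆ ⊆ D
  ⁅⁆-⊆ {w = w} w∈D x∈⁅w⁆ = subst (_∈ _) (sym (x∈⁅y⁆⇒x≡y w x∈⁅w⁆)) w∈D

  ∪⁅⁆-⊆ : ∀ {C D : Subset n} {w} → C ⊆ D → w ∈ D → C ∪ ⁅ w ⁆ ⊆ D
  ∪⁅⁆-⊆ {C} {w = w} C⊆D w∈D x∈ with x∈p∪q⁻ C ⁅ w ⁆ x∈
  ... | inj₁ x∈C   = C⊆D x∈C
  ... | inj₂ x∈⁅w⁆ = ⁅⁆-⊆ w∈D x∈⁅w⁆

  -- A force stays available when the blue set grows (unless its target is already blue),
  -- so a derivation from T can be replayed on top of any reachable superset of T.
  skewReach-absorb : ∀ {S B T C} → SkewReach G S B → SkewReach G T C → T ⊆ B →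
                     ∃ λ D → SkewReach G S D × B ⊆ D × C ⊆ D
  skewReach-absorb rB start T⊆B = _ , rB , id , T⊆B
  skewReach-absorb rB (step {w = w} rC (_ , guw , only-w)) T⊆B
    with skewReach-absorb rB rC T⊆B
  ... | D , rD , B⊆D , C⊆D with w ∈? D
  ...   | yes w∈D = D , rD , B⊆D , ∪⁅⁆-⊆ C⊆D w∈D
  ...   | no w∉D =
    D ∪ ⁅ w ⁆ , step rD (w∉D , guw , λ x x∉D → only-w x (x∉D ∘ C⊆D)) ,
    p⊆p∪q ⁅ w ⁆ ∘ B⊆D , ∪⁅⁆-⊆ (p⊆p∪q ⁅ w ⁆ ∘ C⊆D) (q⊆p∪q D ⁅ w ⁆ (x∈⁅x⁆ w))

  forcing-upward : ∀ {S B T} → SkewReach G S B → T ⊆ B → IsSkewForcing G T → IsSkewForcing G S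
  forcing-upward rB T⊆B F with skewReach-absorb rB F T⊆B
  ... | D , rD , _ , full⊆D = subst (SkewReach G _) (⊆-antisym ⊆⊤ full⊆D) rD

  Blue : Subset n → Fin n → Set
  Blue S x = ∃ λ B → SkewReach G S B × x ∈ B

  blue-start : ∀ {S x} → x ∈ S → Blue S x
  blue-start x∈S = _ , start , x∈S

  blue-force : ∀ {S a u w} → Blue S a → G u w → (∀ x → G u x → x ≡ a ⊎ x ≡ w) → Blue S w
  blue-force {w = w} (B , r , a∈B) guw nbrs with w ∈? B
  ... | yes w∈B = B , r , w∈B
  ... | no w∉B = B ∪ ⁅ w ⁆ , step r (w∉B , guw , only-w) , q⊆p∪q B ⁅ w ⁆ (x∈⁅x⁆ w)
    where
    only-w : ∀ x → x ∉ B → G _ x → x ≡ w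
    only-w x x∉B gux with nbrs x gux
    ... | inj₁ refl = ⊥-elim (x∉B a∈B)
    ... | inj₂ x≡w = x≡w

  blue⇒forcing : ∀ {S c} → Blue S c → IsSkewForcing G ⁅ c ⁆ → IsSkewForcing G S
  blue⇒forcing (B , r , c∈B) = forcing-upward r (⁅⁆-⊆ c∈B)

  blue-everywhere⇒forcing : ∀ {S} → (∀ x → Blue S x) → IsSkewForcing G S
  blue-everywhere⇒forcing {S} blue with covering (allFin n)
    where
    covering : (xs : List (Fin n)) → ∃ λ B → SkewReach G S B × (∀ {x} → x List.∈ xs → x ∈ B)
    covering [] = S , start , λ ()
    covering (x ∷ xs) with blue x | covering xs
    ... | Bx , rx , x∈Bx | B , r , xs⊆B with skewReach-absorb r rx (skewReach-⊇ r)
    ... | D , rD , B⊆D , Bx⊆D = D , rD , λ { (here refl) → Bx⊆D x∈Bx ; (there x∈xs) → B⊆D (xs⊆B x∈xs) }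
  ... | B , r , all⊆B = forcing-upward r (λ {x} _ → all⊆B (∈-allFin x)) start

  NoLeaf : Set
  NoLeaf = ∀ u w → G u w → ∃ λ x → G u x × x ≢ w

  other-neighbour : ∀ {u a b} → G u a → G u b → a ≢ b → ∀ w → ∃ λ x → G u x × x ≢ w
  other-neighbour {a = a} {b} gua gub a≢b w with a ≟ w
  ... | no a≢w = a , gua , a≢w
  ... | yes refl = b , gub , a≢b ∘ sym

  skewReach-empty : NoLeaf → ∀ {B} → SkewReach G empty B → B ≡ empty
  skewReach-empty noLeaf start = refl
  skewReach-empty noLeaf (step r (_ , guw , only-w)) with skewReach-empty noLeaf r
  ... | refl with noLeaf _ _ guw
  ... | x , gux , x≢w = ⊥-elim (x≢w (only-w x ∉⊥ gux))

infixl 6 _⊕_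

_⊕_ : ∀ {n} → Subset n → Subset n → Subset n
_⊕_ = zipWith _xor_

⊕-identityˡ : ∀ {n} (v : Subset n) → empty ⊕ v ≡ v
⊕-identityˡ [] = refl
⊕-identityˡ (b ∷ v) = cong (b ∷_) (⊕-identityˡ v)

⊕-self : ∀ {n} (v : Subset n) → v ⊕ v ≡ empty
⊕-self [] = refl
⊕-self (b ∷ v) = cong₂ _∷_ (xor-same b) (⊕-self v)

⊕-cancelʳ : ∀ {n} (S v : Subset n) → S ⊕ v ⊕ v ≡ S
⊕-cancelʳ [] [] = refl
⊕-cancelʳ (a ∷ S) (b ∷ v) = cong₂ _∷_ xor-cancelʳ (⊕-cancelʳ S v)
  where
  xor-cancelʳ : (a xor b) xor b ≡ a
  xor-cancelʳ = trans (xor-assoc a b b) (trans (cong (a xor_) (xor-same b)) (xor-identityʳ a))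

⊕-translate : ∀ {n} (S T v : Subset n) → (S ⊕ v) ⊕ (T ⊕ v) ≡ S ⊕ T
⊕-translate [] [] [] = refl
⊕-translate (a ∷ S) (b ∷ T) (c ∷ v) = cong₂ _∷_ (xor-translate a b c) (⊕-translate S T v)
  where
  xor-translate : ∀ a b c → (a xor c) xor (b xor c) ≡ a xor b
  xor-translate false false false = refl
  xor-translate false false true  = refl
  xor-translate false true  false = refl
  xor-translate false true  true  = refl
  xor-translate true  false false = refl
  xor-translate true  false true  = refl
  xor-translate true  true  false = refl
  xor-translate true  true  true  = refl

symDiff≡⊕ : ∀ {n} (S T : Subset n) → (S ─ T) ∪ (T ─ S) ≡ S ⊕ T
symDiff≡⊕ [] [] = refl
symDiff≡⊕ (true  ∷ S) (true  ∷ T) = cong (false ∷_) (symDiff≡⊕ S T)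
symDiff≡⊕ (true  ∷ S) (false ∷ T) = cong (true ∷_) (symDiff≡⊕ S T)
symDiff≡⊕ (false ∷ S) (true  ∷ T) = cong (true ∷_) (symDiff≡⊕ S T)
symDiff≡⊕ (false ∷ S) (false ∷ T) = cong (false ∷_) (symDiff≡⊕ S T)

⊕-preserves-SymDiff1 : ∀ {n} (v S T : Subset n) → SymDiff1 S T ⇔ SymDiff1 (S ⊕ v) (T ⊕ v)
⊕-preserves-SymDiff1 v S T = mk⇔ (trans (cong ∣_∣ same)) (trans (cong ∣_∣ (sym same)))
  where
  same : (S ⊕ v ─ T ⊕ v) ∪ (T ⊕ v ─ S ⊕ v) ≡ (S ─ T) ∪ (T ─ S)
  same = begin
    (S ⊕ v ─ T ⊕ v) ∪ (T ⊕ v ─ S ⊕ v) ≡⟨ symDiff≡⊕ (S ⊕ v) (T ⊕ v) ⟩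
    (S ⊕ v) ⊕ (T ⊕ v)                 ≡⟨ ⊕-translate S T v ⟩
    S ⊕ T                             ≡⟨ symDiff≡⊕ S T ⟨
    (S ─ T) ∪ (T ─ S)                 ∎
    where open ≡-Reasoning

module _ {n : ℕ} (G : Graph n) where
  open SkewForcing G

  singletons⇒conclusion : (∀ x → IsSkewForcing G ⁅ x ⁆) → ¬ IsSkewForcing G empty → Conclusion G
  singletons⇒conclusion single ¬forcing-empty = single , ¬forcing-empty , λ v → record
    { to      = _⊕ v
    ; from    = _⊕ v
    ; to-ok   = λ S F S⊕v≡v → ¬forcing-empty (subst (IsSkewForcing G) (⊕≡v⇒≡empty S v S⊕v≡v) F)
    ; from-ok = λ T T≢v → nonempty⇒forcing (T ⊕ v) (T≢v ∘ ⊕v≡empty⇒≡v T v)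
    ; from-to = λ S _ → ⊕-cancelʳ S v
    ; to-from = λ T _ → ⊕-cancelʳ T v
    ; adj     = λ S S′ _ _ → ⊕-preserves-SymDiff1 v S S′
    }
    where
    nonempty⇒forcing : ∀ S → S ≢ empty → IsSkewForcing G S
    nonempty⇒forcing S S≢∅ with nonempty? S
    ... | yes (x , x∈S) = blue⇒forcing (blue-start x∈S) (single x)
    ... | no S-empty = ⊥-elim (S≢∅ (Empty-unique S-empty))

    ⊕≡v⇒≡empty : ∀ S v → S ⊕ v ≡ v → S ≡ empty
    ⊕≡v⇒≡empty S v eq = trans (sym (⊕-cancelʳ S v)) (trans (cong (_⊕ v) eq) (⊕-self v))

    ⊕v≡empty⇒≡v : ∀ T v → T ⊕ v ≡ empty → T ≡ v
    ⊕v≡empty⇒≡v T v eq = trans (sym (⊕-cancelʳ T v)) (trans (cong (_⊕ v) eq) (⊕-identityˡ v))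

-- Unlike 2 * j, dbl (suc j) reduces to suc (suc (dbl j)), which is what stepping
-- two vertices along a petal needs.
dbl : ℕ → ℕ
dbl zero = zero
dbl (suc j) = suc (suc (dbl j))

dbl≡2* : ∀ k → dbl k ≡ 2 * k
dbl≡2* zero = refl
dbl≡2* (suc k) = trans (cong (suc ∘ suc) (dbl≡2* k)) (cong suc (sym (+-suc k (k + 0))))

even⊎even-gap : ∀ k t → t ≤ suc (dbl k) →
                   (∃ λ s → dbl s + 0 ≡ t) ⊎ (∃ λ d → dbl d + t ≡ suc (dbl k))
even⊎even-gap k       zero          _ = inj₁ (0 , refl)
even⊎even-gap k       (suc zero)    _ = inj₂ (k , +-comm (dbl k) 1)
even⊎even-gap zero    (suc (suc t)) (s≤s ())
even⊎even-gap (suc k) (suc (suc t)) (s≤s (s≤s t≤)) with even⊎even-gap k t t≤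
... | inj₁ (s , e) = inj₁ (suc s , cong (suc ∘ suc) e)
... | inj₂ (d , e) = inj₂ (d , trans (+-suc (dbl d) (suc t)) (cong suc (trans (+-suc (dbl d) t) (cong suc e))))

record Petal {n : ℕ} (G : Graph n) (c : Fin n) : Set where
  field
    k                  : ℕ
    nontrivial         : 1 ≤ k
    ℓ                  : ℕ → Fin n
    ℓ-start            : ℓ 0 ≡ c
    ℓ-end              : ℓ (suc (dbl k)) ≡ c
    edge               : ∀ t → t ≤ dbl k → G (ℓ t) (ℓ (suc t))
    interior-nbrs      : ∀ t x → t < dbl k → G (ℓ (suc t)) x → x ≡ ℓ t ⊎ x ≡ ℓ (suc (suc t))
    interior-injective : ∀ t t′ → 1 ≤ t → t ≤ dbl k → t′ ≤ suc (dbl k) → ℓ t ≡ ℓ t′ → t ≡ t′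

module _ {n : ℕ} {G : Graph n} (G-sym : Symmetric G) {c : Fin n} (P : Petal G c) where
  open Petal P
  open SkewForcing G

  private
    jump-up : ∀ {S t} → t < dbl k → Blue S (ℓ t) → Blue S (ℓ (suc (suc t)))
    jump-up {t = t} t<2k b = blue-force b (edge (suc t) t<2k) (λ x g → interior-nbrs t x t<2k g)

    jump-down : ∀ {S t} → t < dbl k → Blue S (ℓ (suc (suc t))) → Blue S (ℓ t)
    jump-down {t = t} t<2k b = blue-force b (G-sym (edge t (<⇒≤ t<2k))) (λ x g → swap (interior-nbrs t x t<2k g))

  blue-jump⇔ : ∀ {S} d t → dbl d + t ≤ suc (dbl k) → Blue S (ℓ t) ⇔ Blue S (ℓ (dbl d + t))
  blue-jump⇔ zero    t _     = ⇔-id _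
  blue-jump⇔ (suc d) t bound =
    mk⇔ (jump-up (s≤s⁻¹ bound)) (jump-down (s≤s⁻¹ bound))
      ⇔-∘ blue-jump⇔ d t (≤-trans (n≤1+n _) (<⇒≤ bound))

  blue-petal⇔centre : ∀ {S t} → t ≤ suc (dbl k) → Blue S (ℓ t) ⇔ Blue S c
  blue-petal⇔centre {S} {t} t≤ with even⊎even-gap k t t≤
  ... | inj₁ (s , refl) =
    subst (λ x → Blue S (ℓ (dbl s + 0)) ⇔ Blue S x) ℓ-start (⇔-sym (blue-jump⇔ s 0 t≤))
  ... | inj₂ (d , e) =
    subst (λ x → Blue S (ℓ t) ⇔ Blue S x) (trans (cong ℓ e) ℓ-end) (blue-jump⇔ d t (≤-reflexive e))

  private
    1≢dbl : ∀ j → 1 ≢ dbl j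
    1≢dbl zero    ()
    1≢dbl (suc j) ()

    2≤dbl : ∀ {j} → 1 ≤ j → 2 ≤ dbl j
    2≤dbl (s≤s _) = s≤s (s≤s z≤n)

    m≢2+m : ∀ m → m ≢ suc (suc m)
    m≢2+m m ()

    ℓ≢ℓ+2 : ∀ t → t < dbl k → ℓ t ≢ ℓ (suc (suc t))
    ℓ≢ℓ+2 zero    _    e = m≢2+m 0 (sym (interior-injective 2 0 (s≤s z≤n) (2≤dbl nontrivial) z≤n (sym e)))
    ℓ≢ℓ+2 (suc t) t<2k e =
      m≢2+m (suc t) (interior-injective (suc t) (3 + t) (s≤s z≤n) (<⇒≤ t<2k) (s≤s t<2k) e)

  two-neighbours : ∀ t → t ≤ dbl k → ∃ λ a → ∃ λ b → G (ℓ t) a × G (ℓ t) b × a ≢ b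
  two-neighbours zero _ =
    ℓ 1 , ℓ (dbl k) , edge 0 z≤n ,
    subst (λ u → G u (ℓ (dbl k))) (trans ℓ-end (sym ℓ-start)) (G-sym (edge (dbl k) ≤-refl)) ,
    1≢dbl k ∘ interior-injective 1 (dbl k) ≤-refl (≤-trans (n≤1+n 1) (2≤dbl nontrivial)) (n≤1+n _)
  two-neighbours (suc t) t<2k =
    ℓ t , ℓ (suc (suc t)) , G-sym (edge t (<⇒≤ t<2k)) , edge (suc t) t<2k , ℓ≢ℓ+2 t t<2k

PetalCover : ∀ {n} → Graph n → Fin n → Set
PetalCover G c = ∀ x → ∃ λ (P : Petal G c) → ∃ λ t → t ≤ dbl (Petal.k P) × x ≡ Petal.ℓ P t

petalCover⇒conclusion : ∀ {n} {G : Graph (suc n)} {c} → Symmetric G → PetalCover G c → Conclusion G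
petalCover⇒conclusion {G = G} {c} G-sym cover = singletons⇒conclusion G single ¬forcing-empty
  where
  open SkewForcing G

  blue⇔centre : ∀ S x → Blue S x ⇔ Blue S c
  blue⇔centre S x with cover x
  ... | P , t , t≤2k , refl = blue-petal⇔centre G-sym P (m≤n⇒m≤1+n t≤2k)

  centre-forcing : IsSkewForcing G ⁅ c ⁆
  centre-forcing = blue-everywhere⇒forcing λ x → Equivalence.from (blue⇔centre _ x) (blue-start (x∈⁅x⁆ c))

  single : ∀ x → IsSkewForcing G ⁅ x ⁆
  single x = blue⇒forcing (Equivalence.to (blue⇔centre _ x) (blue-start (x∈⁅x⁆ x))) centre-forcing

  noLeaf : NoLeaf
  noLeaf u w _ with cover u
  ... | P , t , t≤2k , refl with two-neighbours G-sym P t t≤2k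
  ...   | a , b , ga , gb , a≢b = other-neighbour ga gb a≢b w

  ¬forcing-empty : ¬ IsSkewForcing G empty
  ¬forcing-empty F = ∉⊥ (subst (c ∈_) (skewReach-empty noLeaf F) ∈⊤)

offset-unique : ∀ {K} .{{_ : NonZero K}} p q {t u} → t < K → u < K → p * K + t ≡ q * K + u → t ≡ u
offset-unique {K} p q {t} {u} t<K u<K e = begin
  t               ≡⟨ m<n⇒m%n≡m t<K ⟨
  t % K           ≡⟨ [m+kn]%n≡m%n t p K ⟨
  (t + p * K) % K ≡⟨ cong (_% K) (trans (+-comm t (p * K)) (trans e (+-comm (q * K) u))) ⟩
  (u + q * K) % K ≡⟨ [m+kn]%n≡m%n u q K ⟩
  u % K           ≡⟨ m<n⇒m%n≡m u<K ⟩
  u               ∎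
  where open ≡-Reasoning

module FlowerPetals (r k′ : ℕ) where
  k K : ℕ
  k = suc k′
  K = 2 * k

  G : Graph (suc (r * K))
  G = FlowerAdj r k

  ℓ : Fin r → ℕ → Fin (suc (r * K))
  ℓ p zero = fz
  ℓ p (suc t) with t <? K
  ... | yes t<K = fs (combine p (fromℕ< t<K))
  ... | no _    = fz

  ℓ-value : ∀ p {t} → t < K → toℕ (ℓ p (suc t)) ≡ 1 + toℕ p * K + t
  ℓ-value p {t} t<K with t <? K
  ... | no t≮K = ⊥-elim (t≮K t<K)
  ... | yes t<K′ = cong suc (begin
    toℕ (combine p (fromℕ< t<K′))      ≡⟨ toℕ-combine p (fromℕ< t<K′) ⟩
    K * toℕ p + toℕ (fromℕ< t<K′)      ≡⟨ cong₂ _+_ (*-comm K (toℕ p)) (toℕ-fromℕ< t<K′) ⟩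
    toℕ p * K + t                      ∎)
    where open ≡-Reasoning

  ℓ-beyond : ∀ p {t} → ¬ t < K → ℓ p (suc t) ≡ fz
  ℓ-beyond p {t} t≮K with t <? K
  ... | yes t<K = ⊥-elim (t≮K t<K)
  ... | no _    = refl

  ℓ-combine : ∀ p (j : Fin K) → ℓ p (suc (toℕ j)) ≡ fs (combine p j)
  ℓ-combine p j with toℕ j <? K
  ... | yes j<K = cong (fs ∘ combine p) (fromℕ<-toℕ j j<K)
  ... | no j≮K  = ⊥-elim (j≮K (toℕ<n j))

  0<K : 0 < K
  0<K = s≤s z≤n

  edge : ∀ p t → t ≤ K → G (ℓ p t) (ℓ p (suc t))
  edge p zero _ = inj₂ (inj₂ (inj₁ (refl , toℕ p , toℕ<n p , inj₁ (trans (ℓ-value p 0<K) (+-identityʳ _)))))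
  edge p (suc t) t<K = edge-by (suc t <? K)
    where
    edge-by : Dec (suc t < K) → G (ℓ p (suc t)) (ℓ p (suc (suc t)))
    edge-by (yes t+1<K) = inj₁ (toℕ p , t , toℕ<n p , t+1<K , ℓ-value p t<K ,
                            trans (ℓ-value p t+1<K) (trans (+-suc _ t) (cong suc (sym (ℓ-value p t<K)))))
    edge-by (no t+1≮K) = subst (G (ℓ p (suc t))) (sym (ℓ-beyond p t+1≮K))
                           (inj₂ (inj₂ (inj₂ (refl , toℕ p , toℕ<n p , inj₂ last-value))))
      where
      last-value : toℕ (ℓ p (suc t)) ≡ toℕ p * K + K
      last-value = trans (ℓ-value p t<K)
                         (trans (sym (+-suc _ t)) (cong (toℕ p * K +_) (≤-antisym t<K (≮⇒≥ t+1≮K))))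

  private
    next-by-petal-edge : ∀ p t x q u → t < K → suc u < K →
                         toℕ (ℓ p (suc t)) ≡ 1 + q * K + u → toℕ x ≡ suc (toℕ (ℓ p (suc t))) →
                         x ≡ ℓ p (suc (suc t))
    next-by-petal-edge p t x q u t<K u+1<K a≡ x≡ = toℕ-injective (begin
      toℕ x                          ≡⟨ x≡ ⟩
      suc (toℕ (ℓ p (suc t)))        ≡⟨ cong suc (ℓ-value p t<K) ⟩
      suc (suc (toℕ p * K + t))      ≡⟨ cong suc (+-suc (toℕ p * K) t) ⟨
      suc (toℕ p * K + suc t)        ≡⟨ ℓ-value p t+1<K ⟨
      toℕ (ℓ p (suc (suc t)))        ∎)
      where
      open ≡-Reasoning
      t≡u : t ≡ u
      t≡u = offset-unique (toℕ p) q t<K (<⇒≤ u+1<K) (suc-injective (trans (sym (ℓ-value p t<K)) a≡))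
      t+1<K : suc t < K
      t+1<K = subst (λ v → suc v < K) (sym t≡u) u+1<K

    previous-by-petal-edge : ∀ p t x q u → t < K → suc u < K →
                             toℕ x ≡ 1 + q * K + u → toℕ (ℓ p (suc t)) ≡ suc (toℕ x) →
                             x ≡ ℓ p t
    previous-by-petal-edge p t x q u t<K u+1<K x≡ a≡ = toℕ-injective (begin
      toℕ x                          ≡⟨ x-value ⟩
      toℕ p * K + t                  ≡⟨ cong (toℕ p * K +_) t≡u+1 ⟩
      toℕ p * K + suc u              ≡⟨ +-suc (toℕ p * K) u ⟩
      suc (toℕ p * K + u)            ≡⟨ ℓ-value p (<⇒≤ u+1<K) ⟨
      toℕ (ℓ p (suc u))              ≡⟨ cong (toℕ ∘ ℓ p) t≡u+1 ⟨
      toℕ (ℓ p t)                    ∎)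
      where
      open ≡-Reasoning
      x-value : toℕ x ≡ toℕ p * K + t
      x-value = suc-injective (trans (sym a≡) (ℓ-value p t<K))
      t≡u+1 : t ≡ suc u
      t≡u+1 = offset-unique (toℕ p) q t<K u+1<K (trans (sym x-value) (trans x≡ (sym (+-suc (q * K) u))))

    first-by-centre-edge : ∀ p t x q → t < K → toℕ x ≡ 0 → toℕ (ℓ p (suc t)) ≡ 1 + q * K → x ≡ ℓ p t
    first-by-centre-edge p t x q t<K x≡0 a≡ = toℕ-injective (trans x≡0 (cong (toℕ ∘ ℓ p) (sym t≡0)))
      where
      t≡0 : t ≡ 0
      t≡0 = offset-unique (toℕ p) q t<K 0<K
              (suc-injective (trans (sym (ℓ-value p t<K)) (trans a≡ (cong suc (sym (+-identityʳ (q * K)))))))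

    last-by-centre-edge : ∀ p t x q → t < K → toℕ x ≡ 0 → toℕ (ℓ p (suc t)) ≡ q * K + K →
                          x ≡ ℓ p (suc (suc t))
    last-by-centre-edge p t x q t<K x≡0 a≡ = by-bound (suc t <? K)
      where
      open ≡-Reasoning
      by-bound : Dec (suc t < K) → x ≡ ℓ p (suc (suc t))
      by-bound (no t+1≮K)  = toℕ-injective (trans x≡0 (cong toℕ (sym (ℓ-beyond p t+1≮K))))
      by-bound (yes t+1<K) = ⊥-elim (1+n≢0 (offset-unique (toℕ p) (suc q) t+1<K 0<K (begin
        toℕ p * K + suc t            ≡⟨ +-suc (toℕ p * K) t ⟩
        suc (toℕ p * K + t)          ≡⟨ ℓ-value p t<K ⟨
        toℕ (ℓ p (suc t))            ≡⟨ a≡ ⟩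
        q * K + K                    ≡⟨ +-comm (q * K) K ⟩
        suc q * K                    ≡⟨ +-identityʳ _ ⟨
        suc q * K + 0                ∎)))

  interior-nbrs : ∀ p t x → t < K → G (ℓ p (suc t)) x → x ≡ ℓ p t ⊎ x ≡ ℓ p (suc (suc t))
  interior-nbrs p t x t<K (inj₁ (q , u , _ , u+1<K , a≡ , x≡)) =
    inj₂ (next-by-petal-edge p t x q u t<K u+1<K a≡ x≡)
  interior-nbrs p t x t<K (inj₂ (inj₁ (q , u , _ , u+1<K , x≡ , a≡))) =
    inj₁ (previous-by-petal-edge p t x q u t<K u+1<K x≡ a≡)
  interior-nbrs p t x t<K (inj₂ (inj₂ (inj₁ (a≡0 , _)))) =
    ⊥-elim (1+n≢0 (trans (sym (ℓ-value p t<K)) a≡0))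
  interior-nbrs p t x t<K (inj₂ (inj₂ (inj₂ (x≡0 , q , _ , inj₁ a≡)))) =
    inj₁ (first-by-centre-edge p t x q t<K x≡0 a≡)
  interior-nbrs p t x t<K (inj₂ (inj₂ (inj₂ (x≡0 , q , _ , inj₂ a≡)))) =
    inj₂ (last-by-centre-edge p t x q t<K x≡0 a≡)

  interior-injective : ∀ p t t′ → 1 ≤ t → t ≤ K → t′ ≤ suc K → ℓ p t ≡ ℓ p t′ → t ≡ t′
  interior-injective p (suc t) t′ _ t<K _ e = by-cases t′ e
    where
    by-cases : ∀ t′ → ℓ p (suc t) ≡ ℓ p t′ → suc t ≡ t′
    by-cases zero e = ⊥-elim (1+n≢0 (trans (sym (ℓ-value p t<K)) (cong toℕ e)))
    by-cases (suc t′) e = by-bound (t′ <? K)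
      where
      by-bound : Dec (t′ < K) → suc t ≡ suc t′
      by-bound (yes t′<K) = cong suc (+-cancelˡ-≡ (toℕ p * K) t t′
                              (suc-injective (trans (sym (ℓ-value p t<K)) (trans (cong toℕ e) (ℓ-value p t′<K)))))
      by-bound (no t′≮K)  = ⊥-elim (1+n≢0 (trans (sym (ℓ-value p t<K)) (cong toℕ (trans e (ℓ-beyond p t′≮K)))))

  petal : Fin r → Petal G fz
  petal p = record
    { k                  = k
    ; nontrivial         = s≤s z≤n
    ; ℓ                  = ℓ p
    ; ℓ-start            = refl
    ; ℓ-end              = ℓ-beyond p (<-irrefl (dbl≡2* k))
    ; edge               = λ t t≤2k → edge p t (≤K t≤2k)
    ; interior-nbrs      = λ t x t<2k → interior-nbrs p t x (≤K t<2k)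
    ; interior-injective = λ t t′ 1≤t t≤2k t′≤ →
        interior-injective p t t′ 1≤t (≤K t≤2k) (subst ((t′ ≤_) ∘ suc) (dbl≡2* k) t′≤)
    }
    where
    ≤K : ∀ {t} → t ≤ dbl k → t ≤ K
    ≤K {t} = subst (t ≤_) (dbl≡2* k)

  cover : 1 ≤ r → PetalCover G fz
  cover 1≤r fz = petal (some-petal 1≤r) , 0 , z≤n , refl
    where
    some-petal : 1 ≤ r → Fin r
    some-petal (s≤s _) = fz
  cover _ (fs y) =
    petal p , suc (toℕ j) , subst (suc (toℕ j) ≤_) (sym (dbl≡2* k)) (toℕ<n j) ,
    trans (cong fs (sym (combine-remQuot {r} K y))) (sym (ℓ-combine p j))
    where
    p : Fin r
    p = proj₁ (remQuot {r} K y)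
    j : Fin K
    j = proj₂ (remQuot {r} K y)

flower-sym : ∀ r k → Symmetric (FlowerAdj r k)
flower-sym r k (inj₁ e)                = inj₂ (inj₁ e)
flower-sym r k (inj₂ (inj₁ e))         = inj₁ e
flower-sym r k (inj₂ (inj₂ (inj₁ e)))  = inj₂ (inj₂ (inj₂ e))
flower-sym r k (inj₂ (inj₂ (inj₂ e)))  = inj₂ (inj₂ (inj₁ e))

flower-conclusion : ∀ r k → 1 ≤ r → 1 ≤ k → Conclusion (FlowerAdj r k)
flower-conclusion r (suc k′) 1≤r _ = petalCover⇒conclusion (flower-sym r (suc k′)) (FlowerPetals.cover r k′ 1≤r)

skewReach-resp-⇔ : ∀ {n} {G H : Graph n} {S B} → (∀ i j → G i j ⇔ H i j) → SkewReach G S B → SkewReach H S B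
skewReach-resp-⇔ G⇔H start = start
skewReach-resp-⇔ G⇔H (step r (w∉B , guw , only-w)) =
  step (skewReach-resp-⇔ G⇔H r)
       (w∉B , Equivalence.to (G⇔H _ _) guw , λ x x∉B hux → only-w x x∉B (Equivalence.from (G⇔H _ _) hux))

conclusion-resp-⇔ : ∀ {n} {G H : Graph n} → (∀ i j → G i j ⇔ H i j) → Conclusion G → Conclusion H
conclusion-resp-⇔ {G = G} {H} G⇔H (single , ¬forcing-empty , iso) =
  (λ x → forward (single x)) , ¬forcing-empty ∘ backward , λ v → let open InducedIso (iso v) in record
    { to      = to
    ; from    = from
    ; to-ok   = λ S → to-ok S ∘ backward
    ; from-ok = λ T → forward ∘ from-ok T
    ; from-to = λ S → from-to S ∘ backward
    ; to-from = to-from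
    ; adj     = λ S S′ F F′ → adj S S′ (backward F) (backward F′)
    }
  where
  forward : ∀ {S} → IsSkewForcing G S → IsSkewForcing H S
  forward = skewReach-resp-⇔ G⇔H
  backward : ∀ {S} → IsSkewForcing H S → IsSkewForcing G S
  backward = skewReach-resp-⇔ (λ i j → ⇔-sym (G⇔H i j))

⊎-interchange : ∀ {A B C D : Set} → (A ⊎ B ⊎ C ⊎ D) ⇔ ((A ⊎ C) ⊎ (B ⊎ D))
⊎-interchange {A} {B} {C} {D} = mk⇔ to from
  where
  to : A ⊎ B ⊎ C ⊎ D → (A ⊎ C) ⊎ (B ⊎ D)
  to (inj₁ a)               = inj₁ (inj₁ a)
  to (inj₂ (inj₁ b))        = inj₂ (inj₁ b)
  to (inj₂ (inj₂ (inj₁ c))) = inj₁ (inj₂ c)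
  to (inj₂ (inj₂ (inj₂ d))) = inj₂ (inj₂ d)
  from : (A ⊎ C) ⊎ (B ⊎ D) → A ⊎ B ⊎ C ⊎ D
  from (inj₁ (inj₁ a)) = inj₁ a
  from (inj₂ (inj₁ b)) = inj₂ (inj₁ b)
  from (inj₁ (inj₂ c)) = inj₂ (inj₂ (inj₁ c))
  from (inj₂ (inj₂ d)) = inj₂ (inj₂ (inj₂ d))

symClosure-⇔ : ∀ {X Y X′ Y′ : ℕ → ℕ → Set} {a b} →
               (X a b ⊎ Y a b) ⇔ (X′ a b ⊎ Y′ a b) → (X b a ⊎ Y b a) ⇔ (X′ b a ⊎ Y′ b a) →
               (X a b ⊎ X b a ⊎ Y a b ⊎ Y b a) ⇔ (X′ a b ⊎ X′ b a ⊎ Y′ a b ⊎ Y′ b a)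
symClosure-⇔ ab ba = ⇔-sym ⊎-interchange ⇔-∘ ((ab ⊎-⇔ ba) ⇔-∘ ⊎-interchange)

module _ (m : ℕ) where
  private
    N : ℕ
    N = suc (1 * (2 * m))

  flower⇔cycle-arc : ∀ {a b} → b < N →
                     (PetalEdge 1 m a b ⊎ CenterEdge 1 m a b) ⇔ (b ≡ suc a ⊎ (a ≡ 0 × suc b ≡ N))
  flower⇔cycle-arc {a} {b} b<N = mk⇔ to from
    where
    to : PetalEdge 1 m a b ⊎ CenterEdge 1 m a b → b ≡ suc a ⊎ (a ≡ 0 × suc b ≡ N)
    to (inj₁ (_ , _ , _ , _ , _ , b≡))        = inj₁ b≡
    to (inj₂ (a≡0 , zero , _ , inj₁ b≡1))     = inj₁ (trans b≡1 (cong suc (sym a≡0)))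
    to (inj₂ (a≡0 , zero , _ , inj₂ b≡2m))    = inj₂ (a≡0 , cong suc (trans b≡2m (sym (*-identityˡ (2 * m)))))
    to (inj₂ (_ , suc _ , s≤s () , _))
    from : b ≡ suc a ⊎ (a ≡ 0 × suc b ≡ N) → PetalEdge 1 m a b ⊎ CenterEdge 1 m a b
    from (inj₁ b≡a+1) = from-arc a b≡a+1
      where
      from-arc : ∀ a → b ≡ suc a → PetalEdge 1 m a b ⊎ CenterEdge 1 m a b
      from-arc zero    b≡1   = inj₂ (refl , 0 , s≤s z≤n , inj₁ b≡1)
      from-arc (suc t) b≡t+2 = inj₁ (0 , t , s≤s z≤n , t+2≤2m , refl , b≡t+2)
        where
        t+2≤2m : suc (suc t) ≤ 2 * m
        t+2≤2m = subst (_≤ 2 * m) b≡t+2 (subst (b ≤_) (*-identityˡ (2 * m)) (s≤s⁻¹ b<N))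
    from (inj₂ (a≡0 , b+1≡N)) =
      inj₂ (a≡0 , 0 , s≤s z≤n , inj₂ (trans (suc-injective b+1≡N) (*-identityˡ (2 * m))))

  flower⇔cycle : ∀ i j → FlowerAdj 1 m i j ⇔ CycAdj N i j
  flower⇔cycle i j =
    symClosure-⇔ {X = PetalEdge 1 m} {CenterEdge 1 m} {λ a b → b ≡ suc a} {λ a b → a ≡ 0 × suc b ≡ N}
      (flower⇔cycle-arc (toℕ<n j)) (flower⇔cycle-arc (toℕ<n i))

cycle-conclusion : ∀ m → 1 ≤ m → Conclusion (CycAdj (suc (2 * m)))
cycle-conclusion m 1≤m =
  subst (λ N → Conclusion (CycAdj (suc N))) (*-identityˡ (2 * m))
        (conclusion-resp-⇔ (flower⇔cycle m) (flower-conclusion 1 m ≤-refl 1≤m))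

proposition5p6 : (∀ (n : ℕ) → 3 ≤ n → Odd n → Conclusion (CycAdj n)) ×
    (∀ (r k : ℕ) → 2 ≤ r → 1 ≤ k → Conclusion (FlowerAdj r k))
proposition5p6 = odd-cycle , λ r k 2≤r → flower-conclusion r k (≤-trans (n≤1+n 1) 2≤r)
  where
  odd-cycle : ∀ n → 3 ≤ n → Odd n → Conclusion (CycAdj n)
  odd-cycle _ 3≤n (m , refl) = cycle-conclusion m (positive m 3≤n)
    where
    positive : ∀ m → 3 ≤ suc (2 * m) → 1 ≤ m
    positive zero    (s≤s ())
    positive (suc _) _ = s≤s z≤n
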